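{- Let $k\ge 2$, $n\ge 1$, and let $\mathbf{S}\subseteq\Sigma_k^n$ be nonempty. Let $\mathbf{S}_1,\mathbf{S}_2,\ldots,\mathbf{S}_m$ be a UC-partition of $\mathbf{S}$ with universal cycles $\alpha_1,\alpha_2,\ldots,\alpha_m$ (so $\alpha_i$ is a universal cycle for $\mathbf{S}_i$), let $x$ be the first symbol of $\alpha_1$, and let $\mathcal{U}_{m,n}=\alpha_1\alpha_2\cdots\alpha_m$. Suppose that: (1) $|\alpha_1|\ge n$; (2) the length of the maximal prefix of $\alpha_1$ consisting only of the symbol $x$ is at least the length of the maximal prefix consisting only of $x$ of every $\alpha_i$, $1\le i\le m$; (3) for each $1\le i<m$, the pair $(\text{ext}_n(\alpha_i),\text{ext}_n(\alpha_{i+1}))$ is suffix-related with respect to $(x,n)$. Then $\mathcal{U}_{m,n}$ is a universal cycle for $\mathbf{S}$, and $\text{suff}_n(\mathcal{U}_{m,n})=\text{suff}_n(\text{ext}_n(\alpha_m))$.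
   Context: $\Sigma_k=\{0,1,\ldots,k-1\}$ and $\Sigma_k^n$ is the set of strings of length $n$ over $\Sigma_k$. For a nonempty $\mathbf{S}\subseteq\Sigma_k^n$, a universal cycle for $\mathbf{S}$ is a string of length $|\mathbf{S}|$ which, viewed cyclically, contains every string of $\mathbf{S}$ as a (length-$n$, possibly wrapping around) substring exactly once. A partition of $\mathbf{S}$ into subsets $\mathbf{S}_1,\ldots,\mathbf{S}_m$ is a UC-partition if each $\mathbf{S}_i$ has a universal cycle. For a string $\alpha$ of length at least $\ell$, $\text{suff}_\ell(\alpha)$ and $\text{pre}_\ell(\alpha)$ denote its length-$\ell$ suffix and prefix ($\text{suff}_0$ is the empty string). For a nonempty string $\alpha$, $\text{ext}_n(\alpha)=\alpha^t$ (concatenation of $t$ copies) where $t$ is the smallest integer with $t|\alpha|\ge n$. Suffix-related: let $\alpha=a_1\cdots a_s$, $\beta=b_1\cdots b_t$ with $s,t\ge n>0$ and $x\in\Sigma_k$; let $j$ be the smallest index with $b_j\ne x$ ($j=\infty$ if none). Then $(\alpha,\beta)$ is suffix-related with respect to $(x,n)$ if $j\le n$ and $\text{suff}_{n-j}(\alpha)=\text{suff}_{n-j}(\beta)$. -}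

module Defs where

open import Data.Nat using (ℕ; zero; suc; _+_; _∸_; _≤_; _<_; _≤?_)
open import Data.Fin using (Fin; toℕ)
open import Data.List using (List; []; _∷_; _++_; length; take; drop; takeWhile; reverse; concat; replicate; all)
open import Data.List.Relation.Unary.All using (All)
open import Data.Product using (Σ; ∃; _×_; _,_)
open import Data.Sum using (_⊎_)
open import Relation.Nullary using (¬_; yes; no)
open import Relation.Binary.PropositionalEquality using (_≡_; _≢_)
open import Function.Bundles using (Bijection)
open import Data.Fin using (_≟_)
import Relation.Binary.PropositionalEquality as P

Word : ℕ → Set
Word k = List (Fin k)

WordSet : ℕ → Set₁
WordSet k = Word k → Set

⊆Σ^ : ∀ {k} → ℕ → WordSet k → Set
⊆Σ^ n S = ∀ w → S w → length w ≡ n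

pre : ∀ {k} → ℕ → Word k → Word k
pre ℓ α = take ℓ α

suff : ∀ {k} → ℕ → Word k → Word k
suff ℓ α = drop (length α ∸ ℓ) α

pow : ∀ {k} → ℕ → Word k → Word k
pow t α = concat (replicate t α)

-- ext_n(α) = α^t, t least with t|α| ≥ n (and t ≥ 1).  Computed by
-- appending copies of α to α until length ≥ n; fuel n suffices for nonempty α.
extGo : ∀ {k} → ℕ → ℕ → Word k → Word k → Word k
extGo n zero α acc = acc
extGo n (suc f) α acc with n ≤? length acc
... | yes _ = acc
... | no _ = extGo n f α (acc ++ α)

ext : ∀ {k} → ℕ → Word k → Word k
ext n α = extGo n n α α

-- length-n substring of α viewed cyclically, starting at position i
-- (may wrap around, several times if n > |α|)
window : ∀ {k} → ℕ → (α : Word k) → Fin (length α) → Word k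
window n α i = take n (drop (toℕ i) (pow (suc n) α))

IsUC : ∀ {k} → ℕ → WordSet k → Word k → Set
IsUC n S α =
  1 ≤ length α
  × (∀ i → S (window n α i))
  × (∀ w → S w → ∃ λ i → window n α i ≡ w)
  × (∀ i j → window n α i ≡ window n α j → i ≡ j)

xRun : ∀ {k} → Fin k → Word k → ℕ
xRun x α = length (takeWhile (_≟ x) α)

-- (α, β) suffix-related w.r.t. (x, n).  With j = p + 1 the smallest index
-- with b_j ≠ x:  b_1 … b_p are all x, b_{p+1} ≠ x, j ≤ n, and
-- suff_{n-j}(α) = suff_{n-j}(β).
SuffixRelated : ∀ {k} → Fin k → ℕ → Word k → Word k → Set
SuffixRelated {k} x n α β =
  n ≤ length α × n ≤ length β × 0 < n ×
  (∃ λ p → suc p ≤ n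
     × All (_≡ x) (take p β)
     × (∃ λ (y : Fin k) → ∃ λ rest → drop p β ≡ y ∷ rest × y ≢ x)
     × suff (n ∸ suc p) α ≡ suff (n ∸ suc p) β)

concatF : ∀ {k m} → (Fin m → Word k) → Word k
concatF {m = zero} α = []
concatF {m = suc m} α = α Fin.zero ++ concatF (λ i → α (Fin.suc i))
  where import Data.Fin as Fin

module Submission where

-- Everything is phrased through the periodic reading cyc w i = w[i mod |w|]:
-- the cyclic windows of a word are the windows of its periodic reading
-- (window-cyc), and ext n w is a power of w, so it reads periodically too.
--
-- Let U = β ++ γ, where β and γ
-- both begin with r < min(n, |γ|) symbols x and the last n - r - 1 symbols of β
-- are those of γγγ⋯ just before a period boundary.  Then the window of U at a
-- "front" start is the window of β there, at a "middle" start it is a window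
-- of γ, and at a "back" start (wrapping around) a window of β again.  The
-- resulting assignment of source positions is injective, hence a permutation
-- by pigeonhole; so U is a universal cycle for T ∪ R when β and γ are ones for
-- disjoint T and R.  Moreover U again ends like γ (EndsLike).
--
-- Module Chain derives these hypotheses from the suffix relation between
-- ext α_i and ext α_{i+1} and the x-run condition, and appends the cycles one
-- at a time.  theorem1 follows: the union of the S_i is S, and α_1 ⋯ α_m and
-- ext n α_m both end like α_m, so their length-n suffixes agree.

open import Defs
open import Data.Nat using (ℕ; suc; _≤_; _<_)
open import Data.Fin using (Fin; zero; suc; toℕ; inject₁; fromℕ)
open import Data.List using (List; []; _∷_; length)
open import Data.Product using (Σ; ∃; _×_; _,_)
open import Relation.Nullary using (¬_)
open import Relation.Binary.PropositionalEquality using (_≡_)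
open import Data.Nat using (_+_; _∸_; _*_)

module Indexing {A : Set} where

  open import Data.Nat
  open import Data.Nat.Properties
  open import Data.Nat.DivMod
  open import Data.List using (List; []; _∷_; _++_; length; take; drop; concat; replicate; applyUpTo)
  open import Data.List.Properties using (length-++; ++-identityʳ; ++-assoc)
  open import Data.Product using (_,_)
  open import Relation.Binary.PropositionalEquality
  open import Relation.Nullary using (yes; no)
  open import Function using (_∘_)

  at : A → List A → ℕ → A
  at d [] i = d
  at d (a ∷ w) zero = a
  at d (a ∷ w) (suc i) = at d w i

  at-++ˡ : ∀ d (u v : List A) i → i < length u → at d (u ++ v) i ≡ at d u i
  at-++ˡ d (a ∷ u) v zero _ = refl
  at-++ˡ d (a ∷ u) v (suc i) (s≤s i<u) = at-++ˡ d u v i i<u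

  at-++ʳ : ∀ d (u v : List A) j → at d (u ++ v) (length u + j) ≡ at d v j
  at-++ʳ d [] v j = refl
  at-++ʳ d (a ∷ u) v j = at-++ʳ d u v j

  at-take : ∀ d (w : List A) l i → i < l → at d (take l w) i ≡ at d w i
  at-take d [] (suc l) i _ = refl
  at-take d (a ∷ w) (suc l) zero _ = refl
  at-take d (a ∷ w) (suc l) (suc i) (s≤s i<l) = at-take d w l i i<l

  at-drop : ∀ d (w : List A) t i → at d (drop t w) i ≡ at d w (t + i)
  at-drop d w zero i = refl
  at-drop d [] (suc t) i = refl
  at-drop d (a ∷ w) (suc t) i = at-drop d w t i

  at-applyUpTo : ∀ d (f : ℕ → A) l i → i < l → at d (applyUpTo f l) i ≡ f i
  at-applyUpTo d f (suc l) zero _ = refl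
  at-applyUpTo d f (suc l) (suc i) (s≤s i<l) = at-applyUpTo d (f ∘ suc) l i i<l

  at-ext : ∀ d (u v : List A) → length u ≡ length v →
    (∀ i → i < length u → at d u i ≡ at d v i) → u ≡ v
  at-ext d [] [] _ _ = refl
  at-ext d (a ∷ u) (b ∷ v) eq h =
    cong₂ _∷_ (h 0 (s≤s z≤n)) (at-ext d u v (suc-injective eq) (λ i p → h (suc i) (s≤s p)))

  applyUpTo-cong : ∀ (f g : ℕ → A) l → (∀ i → i < l → f i ≡ g i) → applyUpTo f l ≡ applyUpTo g l
  applyUpTo-cong f g zero h = refl
  applyUpTo-cong f g (suc l) h =
    cong₂ _∷_ (h 0 (s≤s z≤n)) (applyUpTo-cong (f ∘ suc) (g ∘ suc) l (λ i p → h (suc i) (s≤s p)))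

  -- cyc d w i : entry i of the infinite periodic word w w w ⋯ (d if w is empty).
  cyc : A → List A → ℕ → A
  cyc d [] i = d
  cyc d (a ∷ w) i = at d (a ∷ w) (i % suc (length w))

  cyc-< : ∀ d (w : List A) i → i < length w → cyc d w i ≡ at d w i
  cyc-< d (a ∷ w) i i<w = cong (at d (a ∷ w)) (m<n⇒m%n≡m i<w)

  cyc-+period : ∀ d (w : List A) i c → cyc d w (i + c * length w) ≡ cyc d w i
  cyc-+period d [] i c = refl
  cyc-+period d (a ∷ w) i c = cong (at d (a ∷ w)) ([m+kn]%n≡m%n i c (suc (length w)))

  cyc-+length : ∀ d (w : List A) i → cyc d w (i + length w) ≡ cyc d w i
  cyc-+length d w i = trans (cong (λ z → cyc d w (i + z)) (sym (*-identityˡ (length w)))) (cyc-+period d w i 1)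

  cyc-congruent : ∀ d (w : List A) a b i j → a + i * length w ≡ b + j * length w → cyc d w a ≡ cyc d w b
  cyc-congruent d w a b i j eq = trans (sym (cyc-+period d w a i)) (trans (cong (cyc d w) eq) (cyc-+period d w b j))

  cyc-% : ∀ d (w : List A) a e .{{_ : NonZero (length w)}} → cyc d w (a % length w + e) ≡ cyc d w (a + e)
  cyc-% d w a e = cyc-congruent d w _ _ (a / length w) 0 (begin
      a % length w + e + a / length w * length w ≡⟨ +-assoc (a % length w) e _ ⟩
      a % length w + (e + a / length w * length w) ≡⟨ cong (a % length w +_) (+-comm e _) ⟩
      a % length w + (a / length w * length w + e) ≡⟨ sym (+-assoc (a % length w) _ e) ⟩
      a % length w + a / length w * length w + e ≡⟨ cong (_+ e) (sym (m≡m%n+[m/n]*n a (length w))) ⟩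
      a + e ≡⟨ sym (+-identityʳ (a + e)) ⟩
      a + e + 0 ∎)
    where open ≡-Reasoning

  cyc-from-boundary : ∀ d (w : List A) c c' u → u ≤ c * length w → u ≤ c' * length w →
    cyc d w (c * length w ∸ u) ≡ cyc d w (c' * length w ∸ u)
  cyc-from-boundary d w c c' u p q = cyc-congruent d w _ _ c' c (begin
      c * length w ∸ u + c' * length w ≡⟨ sym (+-∸-comm _ p) ⟩
      c * length w + c' * length w ∸ u ≡⟨ cong (_∸ u) (+-comm (c * length w) _) ⟩
      c' * length w + c * length w ∸ u ≡⟨ +-∸-comm _ q ⟩
      c' * length w ∸ u + c * length w ∎)
    where open ≡-Reasoning

  length-power : ∀ c (w : List A) → length (concat (replicate c w)) ≡ c * length w
  length-power zero w = refl
  length-power (suc c) w = trans (length-++ w) (cong (length w +_) (length-power c w))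

  at-power : ∀ d c (w : List A) i → i < c * length w → at d (concat (replicate c w)) i ≡ cyc d w i
  at-power d (suc c) w i i<cw with i <? length w
  ... | yes i<w = trans (at-++ˡ d w _ i i<w) (sym (cyc-< d w i i<w))
  ... | no i≮w with m≤n⇒∃[o]m+o≡n (≮⇒≥ i≮w)
  ...   | j , refl = begin
      at d (w ++ concat (replicate c w)) (length w + j) ≡⟨ at-++ʳ d w _ j ⟩
      at d (concat (replicate c w)) j ≡⟨ at-power d c w j (+-cancelˡ-< (length w) j _ i<cw) ⟩
      cyc d w j ≡⟨ sym (cyc-+length d w j) ⟩
      cyc d w (j + length w) ≡⟨ cong (cyc d w) (+-comm j (length w)) ⟩
      cyc d w (length w + j) ∎
    where open ≡-Reasoning

  power-snoc : ∀ c (w : List A) → concat (replicate c w) ++ w ≡ concat (replicate (suc c) w)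
  power-snoc zero w = sym (++-identityʳ w)
  power-snoc (suc c) w = trans (++-assoc w _ w) (cong (w ++_) (power-snoc c w))

module Words {k : ℕ} where

  open import Data.Nat hiding (_≟_)
  open import Data.Nat.Properties hiding (_≟_)
  open import Data.Fin using (Fin; zero; suc; toℕ; inject₁; fromℕ; _≟_)
  open import Data.Fin.Properties using (toℕ<n)
  open import Data.List using (List; []; _∷_; _++_; length; take; drop; applyUpTo)
  open import Data.List.Properties using (length-++; ++-identityʳ; ++-assoc; length-take; length-drop; length-applyUpTo)
  open import Data.List.Relation.Unary.All using (All; _∷_)
  open import Data.Product using (∃; _×_; _,_)
  open import Data.Empty using (⊥-elim)
  open import Relation.Binary.PropositionalEquality
  open import Relation.Nullary using (yes; no)
  open Indexing

  window-cyc : ∀ d n (w : Word k) (i : Fin (length w)) →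
    window n w i ≡ applyUpTo (λ e → cyc d w (toℕ i + e)) n
  window-cyc d n w i = at-ext d _ _ equal-lengths pointwise
    where
    t = toℕ i
    P = pow (suc n) w
    t<w : t < length w
    t<w = toℕ<n i
    n≤nw : n ≤ n * length w
    n≤nw = m≤m*n n (length w) {{>-nonZero (≤-<-trans z≤n t<w)}}
    fits : n ≤ length P ∸ t
    fits = subst (λ z → n ≤ z ∸ t) (sym (length-power (suc n) w))
             (subst (_≤ length w + n * length w ∸ t) (m+n∸m≡n t n)
               (∸-monoˡ-≤ t (+-mono-≤ (<⇒≤ t<w) n≤nw)))
    length-window : length (take n (drop t P)) ≡ n
    length-window = trans (length-take n _) (trans (cong (n ⊓_) (length-drop t P)) (m≤n⇒m⊓n≡m fits))
    equal-lengths : length (take n (drop t P)) ≡ length (applyUpTo (λ e → cyc d w (t + e)) n)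
    equal-lengths = trans length-window (sym (length-applyUpTo _ n))
    pointwise : ∀ e → e < length (take n (drop t P)) →
      at d (take n (drop t P)) e ≡ at d (applyUpTo (λ e → cyc d w (t + e)) n) e
    pointwise e e<len = begin
      at d (take n (drop t P)) e ≡⟨ at-take d _ n e e<n ⟩
      at d (drop t P) e ≡⟨ at-drop d P t e ⟩
      at d P (t + e) ≡⟨ at-power d (suc n) w (t + e) (+-mono-<-≤ t<w (≤-trans (<⇒≤ e<n) n≤nw)) ⟩
      cyc d w (t + e) ≡⟨ sym (at-applyUpTo d _ n e e<n) ⟩
      at d (applyUpTo (λ e → cyc d w (t + e)) n) e ∎
      where
      open ≡-Reasoning
      e<n : e < n
      e<n = subst (e <_) length-window e<len

  extGo-power : ∀ n (w acc : Word k) f c → acc ≡ pow (suc c) w → n ≤ f + length acc → 1 ≤ length w →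
    ∃ λ c' → extGo n f w acc ≡ pow (suc c') w × n ≤ length (pow (suc c') w)
  extGo-power n w acc zero c refl n≤ _ = c , refl , n≤
  extGo-power n w acc (suc f) c acc≡ n≤ 1≤w with n ≤? length acc
  ... | yes n≤acc = c , acc≡ , subst (λ z → n ≤ length z) acc≡ n≤acc
  ... | no _ = extGo-power n w (acc ++ w) f (suc c) (trans (cong (_++ w) acc≡) (power-snoc (suc c) w)) fuel 1≤w
    where
    fuel : n ≤ f + length (acc ++ w)
    fuel = ≤-trans n≤ (begin
      suc f + length acc ≡⟨ +-comm (suc f) _ ⟩
      length acc + suc f ≡⟨ +-suc (length acc) f ⟩
      suc (length acc + f) ≤⟨ +-monoˡ-≤ f (subst (_≤ length acc + length w) (+-comm (length acc) 1) (+-monoʳ-≤ (length acc) 1≤w)) ⟩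
      length acc + length w + f ≡⟨ +-comm _ f ⟩
      f + (length acc + length w) ≡⟨ cong (f +_) (sym (length-++ acc)) ⟩
      f + length (acc ++ w) ∎)
      where open ≤-Reasoning

  ext-power : ∀ n (w : Word k) → 1 ≤ length w → ∃ λ c → ext n w ≡ pow (suc c) w × n ≤ length (pow (suc c) w)
  ext-power n w 1≤w = extGo-power n w w n 0 (sym (++-identityʳ w)) (m≤m+n n (length w)) 1≤w

  xRun-at : ∀ (d x : Fin k) w i → i < xRun x w → at d w i ≡ x
  xRun-at d x (a ∷ w) i i<run with a ≟ x
  xRun-at d x (a ∷ w) zero _ | yes a≡x = a≡x
  xRun-at d x (a ∷ w) (suc i) (s≤s i<run) | yes _ = xRun-at d x w i i<run
  xRun-at d x (a ∷ w) i () | no _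

  xRun-≥ : ∀ (d x : Fin k) w p → p ≤ length w → (∀ i → i < p → at d w i ≡ x) → p ≤ xRun x w
  xRun-≥ d x w zero _ _ = z≤n
  xRun-≥ d x (a ∷ w) (suc p) (s≤s p≤w) allx with a ≟ x
  ... | yes _ = s≤s (xRun-≥ d x w p p≤w (λ i i<p → allx (suc i) (s≤s i<p)))
  ... | no a≢x = ⊥-elim (a≢x (allx 0 (s≤s z≤n)))

  xRun-++ : ∀ (x : Fin k) u v → xRun x u ≤ xRun x (u ++ v)
  xRun-++ x [] v = z≤n
  xRun-++ x (a ∷ u) v with a ≟ x
  ... | yes _ = s≤s (xRun-++ x u v)
  ... | no _ = z≤n

  All-at : ∀ {P : Fin k → Set} d (w : Word k) i → All P w → i < length w → P (at d w i)
  All-at d (a ∷ w) zero (pa ∷ _) _ = pa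
  All-at d (a ∷ w) (suc i) (_ ∷ pw) (s≤s i<w) = All-at d w i pw i<w

  drop≡∷⇒at : ∀ d (w : Word k) p y rest → drop p w ≡ y ∷ rest → p < length w × at d w p ≡ y
  drop≡∷⇒at d (a ∷ w) zero y rest refl = s≤s z≤n , refl
  drop≡∷⇒at d (a ∷ w) (suc p) y rest eq with drop≡∷⇒at d w p y rest eq
  ... | p<w , at≡y = s≤s p<w , at≡y

  All-take⇒at : ∀ {P : Fin k → Set} d (w : Word k) p → All P (take p w) → p ≤ length w → ∀ i → i < p → P (at d w i)
  All-take⇒at {P} d w p all p≤w i i<p = subst P (at-take d w p i i<p)
    (All-at d (take p w) i all (subst (i <_) (sym (trans (length-take p w) (m≤n⇒m⊓n≡m p≤w))) i<p))

  run<period : ∀ d x (w V : Word k) p → 1 ≤ length w → (∀ i → i < length V → at d V i ≡ cyc d w i) →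
    (∀ i → i < p → at d V i ≡ x) → p < length V → at d V p ≢ x → p < length w
  run<period d x w V p 1≤w periodic run p<V stop with p <? length w
  ... | yes p<w = p<w
  ... | no p≮w with m≤n⇒∃[o]m+o≡n (≮⇒≥ p≮w)
  ...   | j , w+j≡p = ⊥-elim (stop (begin
      at d V p ≡⟨ periodic p p<V ⟩
      cyc d w p ≡⟨ cong (cyc d w) (sym (trans (+-comm j (length w)) w+j≡p)) ⟩
      cyc d w (j + length w) ≡⟨ cyc-+length d w j ⟩
      cyc d w j ≡⟨ sym (periodic j (<-trans j<p p<V)) ⟩
      at d V j ≡⟨ run j j<p ⟩
      x ∎))
    where open ≡-Reasoning
          j<p : j < p
          j<p = subst (j <_) w+j≡p (+-monoˡ-≤ j 1≤w)

  length-suff : ∀ l (w : Word k) → l ≤ length w → length (suff l w) ≡ l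
  length-suff l w l≤w = trans (length-drop (length w ∸ l) w) (m∸[m∸n]≡n l≤w)

  at-suff : ∀ d l (w : Word k) u → u ≤ l → l ≤ length w → at d (suff l w) (l ∸ u) ≡ at d w (length w ∸ u)
  at-suff d l w u u≤l l≤w = trans (at-drop d w (length w ∸ l) (l ∸ u))
    (cong (at d w) (trans (sym (+-∸-assoc (length w ∸ l) u≤l)) (cong (_∸ u) (m∸n+n≡m l≤w))))

  suff-≡ : ∀ d l (v w : Word k) → l ≤ length v → l ≤ length w →
    (∀ u → 1 ≤ u → u ≤ l → at d v (length v ∸ u) ≡ at d w (length w ∸ u)) → suff l v ≡ suff l w
  suff-≡ d l v w l≤v l≤w tails = at-ext d _ _ (trans (length-suff l v l≤v) (sym (length-suff l w l≤w))) pointwise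
    where
    pointwise : ∀ e → e < length (suff l v) → at d (suff l v) e ≡ at d (suff l w) e
    pointwise e e<len = begin
      at d (suff l v) e ≡⟨ cong (at d (suff l v)) (sym e≡) ⟩
      at d (suff l v) (l ∸ (l ∸ e)) ≡⟨ at-suff d l v (l ∸ e) (m∸n≤m l e) l≤v ⟩
      at d v (length v ∸ (l ∸ e)) ≡⟨ tails (l ∸ e) (m<n⇒0<n∸m e<l) (m∸n≤m l e) ⟩
      at d w (length w ∸ (l ∸ e)) ≡⟨ sym (at-suff d l w (l ∸ e) (m∸n≤m l e) l≤w) ⟩
      at d (suff l w) (l ∸ (l ∸ e)) ≡⟨ cong (at d (suff l w)) e≡ ⟩
      at d (suff l w) e ∎
      where
      open ≡-Reasoning
      e<l : e < l
      e<l = subst (e <_) (length-suff l v l≤v) e<len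
      e≡ : l ∸ (l ∸ e) ≡ e
      e≡ = m∸[m∸n]≡n (<⇒≤ e<l)

  suff-≡⇒tail : ∀ d l (v w : Word k) → l ≤ length v → l ≤ length w → suff l v ≡ suff l w →
    ∀ u → u ≤ l → at d v (length v ∸ u) ≡ at d w (length w ∸ u)
  suff-≡⇒tail d l v w l≤v l≤w eq u u≤l =
    trans (sym (at-suff d l v u u≤l l≤v)) (trans (cong (λ z → at d z (l ∸ u)) eq) (at-suff d l w u u≤l l≤w))

  -- This is the invariant carried
  -- along the concatenation; it pins down suff n U.
  EndsLike : ℕ → Fin k → Word k → Word k → Set
  EndsLike n x U w = ∀ u → 1 ≤ u → u ≤ n → at x U (length U ∸ u) ≡ cyc x w (n * length w ∸ u)

  power-endsLike : ∀ n x c (w : Word k) → 1 ≤ length w → n ≤ length (pow c w) → EndsLike n x (pow c w) w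
  power-endsLike n x c w 1≤w n≤pow u 1≤u u≤n = begin
      at x (pow c w) (length (pow c w) ∸ u) ≡⟨ cong (λ z → at x (pow c w) (z ∸ u)) len ⟩
      at x (pow c w) (c * length w ∸ u) ≡⟨ at-power x c w _ (∸-monoʳ-< 1≤u (subst (_≤_ u) len (≤-trans u≤n n≤pow))) ⟩
      cyc x w (c * length w ∸ u) ≡⟨ cyc-from-boundary x w c n u (subst (_≤_ u) len (≤-trans u≤n n≤pow)) u≤nw ⟩
      cyc x w (n * length w ∸ u) ∎
    where
    open ≡-Reasoning
    len : length (pow c w) ≡ c * length w
    len = length-power c w
    u≤nw : u ≤ n * length w
    u≤nw = ≤-trans u≤n (m≤m*n n (length w) {{>-nonZero 1≤w}})

  ext-endsLike : ∀ n x (w : Word k) → 1 ≤ length w → EndsLike n x (ext n w) w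
  ext-endsLike n x w 1≤w with ext-power n w 1≤w
  ... | c , ext≡ , n≤ = subst (λ z → EndsLike n x z w) (sym ext≡) (power-endsLike n x (suc c) w 1≤w n≤)

  ext-reads : ∀ n d (w : Word k) → 1 ≤ length w → ∀ i → i < length (ext n w) → at d (ext n w) i ≡ cyc d w i
  ext-reads n d w 1≤w i i<ext with ext-power n w 1≤w
  ... | c , ext≡ , _ = trans (cong (λ v → at d v i) ext≡)
        (at-power d (suc c) w i (subst (i <_) (trans (cong length ext≡) (length-power (suc c) w)) i<ext))

  ext-long : ∀ n (w : Word k) → 1 ≤ length w → n ≤ length (ext n w)
  ext-long n w 1≤w with ext-power n w 1≤w
  ... | c , ext≡ , n≤ = subst (λ v → n ≤ length v) (sym ext≡) n≤

  IsUC-cong : ∀ {n} {S S' : WordSet k} {w : Word k} →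
    (∀ v → S v → S' v) → (∀ v → S' v → S v) → IsUC n S w → IsUC n S' w
  IsUC-cong to from (1≤w , inS , onto , inj) = 1≤w , (λ i → to _ (inS i)) , (λ v s' → onto v (from v s')) , inj

  concatF-snoc : ∀ m (α : Fin (suc (suc m)) → Word k) →
    concatF α ≡ concatF (λ i → α (inject₁ i)) ++ α (fromℕ (suc m))
  concatF-snoc zero α = trans (cong (α zero ++_) (++-identityʳ _)) (sym (++-assoc (α zero) [] _))
  concatF-snoc (suc m) α = trans (cong (α zero ++_) (concatF-snoc m (λ i → α (suc i)))) (sym (++-assoc (α zero) _ _))

module FinFacts where

  open import Data.Nat using (zero; suc)
  open import Data.Nat.Properties using (<-irrefl)
  open import Data.Fin using (Fin; zero; suc; inject₁; fromℕ; _≟_; punchOut)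
  open import Data.Fin.Properties using (any?; punchOut-injective; injective⇒≤)
  open import Data.Product using (∃; _,_)
  open import Data.Sum using (_⊎_; inj₁; inj₂)
  open import Data.Empty using (⊥-elim)
  open import Relation.Binary.PropositionalEquality
  open import Relation.Nullary using (yes; no)

  inject₁-or-last : ∀ {m} (i : Fin (suc m)) → (∃ λ i' → i ≡ inject₁ i') ⊎ i ≡ fromℕ m
  inject₁-or-last {zero} zero = inj₂ refl
  inject₁-or-last {suc m} zero = inj₁ (zero , refl)
  inject₁-or-last {suc m} (suc i) with inject₁-or-last i
  ... | inj₁ (i' , refl) = inj₁ (suc i' , refl)
  ... | inj₂ refl = inj₂ refl

  injective⇒onto : ∀ {N} (F : Fin N → Fin N) → (∀ i j → F i ≡ F j → i ≡ j) → ∀ y → ∃ λ i → F i ≡ y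
  injective⇒onto {suc N} F inj y with any? (λ i → F i ≟ y)
  ... | yes hit = hit
  ... | no miss = ⊥-elim (<-irrefl refl (injective⇒≤ {f = avoid} avoid-injective))
    where
    avoid : Fin (suc N) → Fin N
    avoid i = punchOut {i = y} {j = F i} (λ eq → miss (i , sym eq))
    avoid-injective : ∀ {i j} → avoid i ≡ avoid j → i ≡ j
    avoid-injective {i} {j} eq = inj i j (punchOut-injective {i = y} (λ e → miss (i , sym e)) (λ e → miss (j , sym e)) eq)

-- Linear arithmetic used in the case analysis of windows of β ++ γ.  Throughout,
-- L = |β|, M = |γ|, a window starts at t and has length n, and r is the length
-- of the common x-prefix of β and γ.
module Arithmetic where

  open import Data.Nat
  open import Data.Nat.Properties
  open import Data.Nat.DivMod
  open import Data.Nat.Tactic.RingSolver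
  open import Data.Product using (∃; _,_)
  open import Data.Empty using (⊥; ⊥-elim)
  open import Relation.Binary.PropositionalEquality
  open import Relation.Nullary using (yes; no)

  +≡⇒≤ : ∀ a w b → a + w ≡ b → a ≤ b
  +≡⇒≤ a w b eq = subst (a ≤_) eq (m≤m+n a w)

  +≡⇒∸≡ : ∀ a b c → a + b ≡ c → c ∸ b ≡ a
  +≡⇒∸≡ a b c eq = trans (cong (_∸ b) (sym eq)) (m+n∸n≡m a b)

  <⇒∃suc : ∀ {a b} → a < b → ∃ λ v → a + suc v ≡ b
  <⇒∃suc {a} a<b with m≤n⇒∃[o]m+o≡n a<b
  ... | v , eq = v , trans (+-suc a v) eq

  residue-shift : ∀ M a c .{{_ : NonZero M}} → (a + c) % M ≡ (a % M + c) % M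
  residue-shift M a c = trans (cong (λ z → (z + c) % M) (m≡m%n+[m/n]*n a M))
    (trans (cong (_% M) (reassoc (a % M) (a / M) c M)) ([m+kn]%n≡m%n (a % M + c) (a / M) M))
    where reassoc : ∀ p q c M → p + q * M + c ≡ p + c + q * M
          reassoc = solve-∀

  %-shift≡⇒0 : ∀ M a c .{{_ : NonZero M}} → c < M → (a + c) % M ≡ a % M → c ≡ 0
  %-shift≡⇒0 M a c c<M eq with a % M + c <? M
  ... | yes small = +-cancelˡ-≡ (a % M) c 0
        (trans (sym (m<n⇒m%n≡m small)) (trans (sym (residue-shift M a c)) (trans eq (sym (+-identityʳ _)))))
  ... | no big = ⊥-elim (<-irrefl refl (<-≤-trans c<M (+-cancelˡ-≤ (a % M) M c (≤-reflexive wrap))))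
    where
    M≤ : M ≤ a % M + c
    M≤ = ≮⇒≥ big
    reduced : a % M + c ∸ M ≡ a % M
    reduced = trans (sym (m<n⇒m%n≡m (+-cancelʳ-< M _ M (subst (_< M + M) (sym (m∸n+n≡m M≤)) (+-mono-< (m%n<n a M) c<M)))))
                (trans (m≤n⇒[n∸m]%m≡n%m M≤) (trans (sym (residue-shift M a c)) eq))
    wrap : a % M + M ≡ a % M + c
    wrap = trans (cong (_+ M) (sym reduced)) (m∸n+n≡m M≤)

  front-start<L : ∀ t n L r → t + n ≤ L + r → r < n → t < L
  front-start<L t n L r front r<n = +-cancelʳ-< n t L (≤-<-trans front (+-monoʳ-< L r<n))

  overhang<r : ∀ L j t e n r → L + j ≡ t + e → e < n → t + n ≤ L + r → j < r
  overhang<r L j t e n r eq e<n bound = +-cancelˡ-< L j r (subst (_< L + r) (sym eq) (<-≤-trans (+-monoʳ-< t e<n) bound))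

  back-start≥M : ∀ L M r t n → L + M + r < t + n → n ≤ L → M ≤ t
  back-start≥M L M r t n back n≤L = <⇒≤ (+-cancelʳ-< L M t
    (subst (_< t + L) (+-comm L M) (≤-<-trans (m≤m+n (L + M) r) (<-≤-trans back (+-monoʳ-≤ t n≤L)))))

  back-offset<L : ∀ M s L → M + s < L + M → s < L
  back-offset<L M s L lt = +-cancelˡ-< M s L (subst (M + s <_) (+-comm L M) lt)

  front-back-disjoint : ∀ t n L r M → t + n ≤ L + r → L + M + r < M + t + n → ⊥
  front-back-disjoint t n L r M front back = <-irrefl refl (<-≤-trans (subst (_< M + t + n) (eq₁ L M r) back)
    (subst (_≤ L + r + M) (eq₂ t M n) (+-monoˡ-≤ M front)))
    where eq₁ : ∀ L M r → L + M + r ≡ L + r + M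
          eq₁ = solve-∀
          eq₂ : ∀ t M n → t + n + M ≡ M + t + n
          eq₂ = solve-∀

  back-tail-bound : ∀ L M s e u r n → s + e + u ≡ L → L + M + r < M + s + n → u + r < n
  back-tail-bound .(s + e + u) M s e u r n refl back =
    ≤-trans (s≤s (m≤n+m (u + r) e)) (+-cancelˡ-≤ (M + s) _ _ (subst (_≤ M + s + n) (eq M s e u r) back))
    where eq : ∀ M s e u r → suc (s + e + u + M + r) ≡ M + s + suc (e + (u + r))
          eq = solve-∀

  back-in-γ-offset : ∀ L j M s e u → L + j ≡ M + s + e → j + u ≡ M → s + e + u ≡ L
  back-in-γ-offset L j .(j + u) s e u eq refl = sym (+-cancelʳ-≡ j L (s + e + u) (trans eq (reorder j u s e)))
    where reorder : ∀ j u s e → j + u + s + e ≡ s + e + u + j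
          reorder = solve-∀

  back-wrap-offset : ∀ L M j s e → L + M + j ≡ M + s + e → s + e ≡ L + j
  back-wrap-offset L M j s e eq = +-cancelˡ-≡ M (s + e) (L + j) (trans (sym (+-assoc M s e)) (trans (sym eq) (reorder L M j)))
    where reorder : ∀ L M j → L + M + j ≡ M + (L + j)
          reorder = solve-∀

  -- Middle windows: t + n·M = L + A, so the window reads γ from the residue of A.
  middle-tail-bound : ∀ L t e u r n → t + e + u ≡ L → L + r < t + n → u + r < n
  middle-tail-bound .(t + e + u) t e u r n refl middle =
    ≤-trans (s≤s (m≤n+m (u + r) e)) (+-cancelˡ-≤ t _ _ (subst (_≤ t + n) (eq t e u r) middle))
    where eq : ∀ t e u r → suc (t + e + u + r) ≡ t + suc (e + (u + r))
          eq = solve-∀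

  middle-tail-offset : ∀ L A t nM e u → L + A ≡ t + nM → t + e + u ≡ L → A + e + u ≡ nM
  middle-tail-offset .(t + e + u) A t nM e u eq refl = +-cancelˡ-≡ t _ _ (trans (reorder t e u A) eq)
    where reorder : ∀ t e u A → t + (A + e + u) ≡ t + e + u + A
          reorder = solve-∀

  middle-γ-offset : ∀ L A t nM e j → L + A ≡ t + nM → L + j ≡ t + e → A + e ≡ j + nM
  middle-γ-offset L A t nM e j eq₁ eq₂ = +-cancelˡ-≡ L _ _ (begin
      L + (A + e) ≡⟨ sym (+-assoc L A e) ⟩
      L + A + e ≡⟨ cong (_+ e) eq₁ ⟩
      t + nM + e ≡⟨ reorder t nM e ⟩
      t + e + nM ≡⟨ cong (_+ nM) (sym eq₂) ⟩
      L + j + nM ≡⟨ +-assoc L j nM ⟩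
      L + (j + nM) ∎)
    where open ≡-Reasoning
          reorder : ∀ t nM e → t + nM + e ≡ t + e + nM
          reorder = solve-∀

  middle-wrap-offset : ∀ L M A t nM e j → L + A ≡ t + nM → L + M + j ≡ t + e → A + e ≡ j + (M + nM)
  middle-wrap-offset L M A t nM e j eq₁ eq₂ = +-cancelˡ-≡ L _ _ (begin
      L + (A + e) ≡⟨ sym (+-assoc L A e) ⟩
      L + A + e ≡⟨ cong (_+ e) eq₁ ⟩
      t + nM + e ≡⟨ reorder t nM e ⟩
      t + e + nM ≡⟨ cong (_+ nM) (sym eq₂) ⟩
      L + M + j + nM ≡⟨ reorder₂ L M j nM ⟩
      L + (j + (M + nM)) ∎)
    where open ≡-Reasoning
          reorder : ∀ t nM e → t + nM + e ≡ t + e + nM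
          reorder = solve-∀
          reorder₂ : ∀ L M j nM → L + M + j + nM ≡ L + (j + (M + nM))
          reorder₂ = solve-∀

  middle-span<M : ∀ t c n L M r → L + r < t + n → t + c + n ≤ L + M + r → c < M
  middle-span<M t c n L M r middle₁ middle₂ = +-cancelˡ-< (t + n) c M (subst (_< t + n + M) (eq₁ t c n)
    (≤-<-trans middle₂ (subst (_< t + n + M) (eq₂ L M r) (+-monoˡ-< M middle₁))))
    where eq₁ : ∀ t c n → t + c + n ≡ t + n + c
          eq₁ = solve-∀
          eq₂ : ∀ L M r → L + r + M ≡ L + M + r
          eq₂ = solve-∀

module Merge {k : ℕ} (x : Fin k) (n : ℕ) (β γ : Word k) (r : ℕ)
  (n≤L : n ≤ length β) (r<M : r < length γ) (r<n : r < n)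
  (β-prefix : ∀ i → i < r → Indexing.at x β i ≡ x)
  (γ-prefix : ∀ i → i < r → Indexing.at x γ i ≡ x)
  (β-tail : ∀ u → 1 ≤ u → u + r < n → Indexing.at x β (length β ∸ u) ≡ Indexing.cyc x γ (n * length γ ∸ u))
  where

  open import Data.Nat hiding (_≟_)
  open import Data.Nat.Properties hiding (_≟_)
  open import Data.Nat.DivMod
  open import Data.Nat.Tactic.RingSolver
  open import Data.Fin using (Fin; toℕ; fromℕ<)
  open import Data.Fin.Properties using (toℕ<n; toℕ-fromℕ<; toℕ-injective; fromℕ<-injective)
  open import Data.List using (_++_; length; applyUpTo)
  open import Data.List.Properties using (length-++)
  open import Data.Product using (∃; _×_; _,_; proj₁; proj₂)
  open import Data.Sum using (_⊎_; inj₁; inj₂)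
  open import Data.Empty using (⊥; ⊥-elim)
  open import Relation.Binary.PropositionalEquality
  open import Relation.Nullary using (yes; no)
  open Indexing
  open Words
  open FinFacts
  open Arithmetic

  L M N : ℕ
  L = length β
  M = length γ
  N = L + M

  U : Word k
  U = β ++ γ

  instance
    M-nonZero : NonZero M
    M-nonZero = >-nonZero (≤-<-trans z≤n r<M)

  n≤nM : n ≤ n * M
  n≤nM = m≤m*n n M

  M≤nM : M ≤ n * M
  M≤nM = m≤n*m M n {{>-nonZero (≤-<-trans z≤n r<n)}}

  r<L : r < L
  r<L = <-≤-trans r<n n≤L

  length-U : length U ≡ N
  length-U = length-++ β

  cycU-β : ∀ i → i < L → cyc x U i ≡ at x β i
  cycU-β i i<L = trans (cyc-< x U i (subst (i <_) (sym length-U) (≤-trans i<L (m≤m+n L M)))) (at-++ˡ x β γ i i<L)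

  cycU-γ : ∀ j → j < M → cyc x U (L + j) ≡ at x γ j
  cycU-γ j j<M = trans (cyc-< x U (L + j) (subst (L + j <_) (sym length-U) (+-monoʳ-< L j<M))) (at-++ʳ x β γ j)

  cycU-wrap : ∀ j → j < L → cyc x U (N + j) ≡ at x β j
  cycU-wrap j j<L = trans (cong (cyc x U) (trans (+-comm N j) (cong (j +_) (sym length-U)))) (trans (cyc-+length x U j) (cycU-β j j<L))

  cycβ-wrap : ∀ j → j < L → cyc x β (L + j) ≡ at x β j
  cycβ-wrap j j<L = trans (cong (cyc x β) (+-comm L j)) (trans (cyc-+length x β j) (cyc-< x β j j<L))

  cycγ-back : ∀ c u a → u ≤ c * M → a + u ≡ M → cyc x γ (c * M ∸ u) ≡ cyc x γ a
  cycγ-back c u a u≤cM a+u≡M = cyc-congruent x γ _ _ 1 c (begin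
      c * M ∸ u + 1 * M ≡⟨ cong (c * M ∸ u +_) (trans (*-identityˡ M) (sym a+u≡M)) ⟩
      c * M ∸ u + (a + u) ≡⟨ swap (c * M ∸ u) a u ⟩
      a + (c * M ∸ u + u) ≡⟨ cong (a +_) (m∸n+n≡m u≤cM) ⟩
      a + c * M ∎)
    where open ≡-Reasoning
          swap : ∀ y a u → y + (a + u) ≡ a + (y + u)
          swap = solve-∀

  cycγ-back-period : ∀ c u → u + M ≤ c * M → cyc x γ (c * M ∸ (u + M)) ≡ cyc x γ (c * M ∸ u)
  cycγ-back-period c u u+M≤cM = cyc-congruent x γ _ _ 1 0 (begin
      c * M ∸ (u + M) + 1 * M ≡⟨ cong₂ _+_ (sym (∸-+-assoc (c * M) u M)) (*-identityˡ M) ⟩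
      c * M ∸ u ∸ M + M ≡⟨ m∸n+n≡m M≤ ⟩
      c * M ∸ u ≡⟨ sym (+-identityʳ _) ⟩
      c * M ∸ u + 0 * M ∎)
    where open ≡-Reasoning
          M≤ : M ≤ c * M ∸ u
          M≤ = subst (_≤ c * M ∸ u) (m+n∸m≡n u M) (∸-monoˡ-≤ u u+M≤cM)

  -- Symbol e of the window of U at t, in each of the three regions of t:
  -- front (t + n ≤ L + r): the window overlaps γ only inside its x-prefix, so it reads as β;
  front-symbol : ∀ t e → t + n ≤ L + r → e < n → cyc x U (t + e) ≡ cyc x β (t + e)
  front-symbol t e front e<n with t + e <? L
  ... | yes in-β = trans (cycU-β _ in-β) (sym (cyc-< x β _ in-β))
  ... | no past-β with m≤n⇒∃[o]m+o≡n (≮⇒≥ past-β)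
  ...   | j , L+j≡ = begin
      cyc x U (t + e) ≡⟨ cong (cyc x U) (sym L+j≡) ⟩
      cyc x U (L + j) ≡⟨ cycU-γ j (<-trans j<r r<M) ⟩
      at x γ j ≡⟨ γ-prefix j j<r ⟩
      x ≡⟨ sym (β-prefix j j<r) ⟩
      at x β j ≡⟨ sym (cycβ-wrap j (<-trans j<r r<L)) ⟩
      cyc x β (L + j) ≡⟨ cong (cyc x β) L+j≡ ⟩
      cyc x β (t + e) ∎
    where open ≡-Reasoning
          j<r : j < r
          j<r = overhang<r L j t e n r L+j≡ e<n front

  -- middle (L + r < t + n ≤ N + r): the part in β lies in its tail, so the window reads as γγγ⋯;
  middle-symbol : ∀ t A e → L + A ≡ t + n * M → L + r < t + n → t + n ≤ N + r → e < n →
    cyc x U (t + e) ≡ cyc x γ (A + e)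
  middle-symbol t A e L+A≡ middle₁ middle₂ e<n with t + e <? L
  ... | yes in-β with <⇒∃suc in-β
  ...   | v , t+e+v≡ = begin
      cyc x U (t + e) ≡⟨ cycU-β _ in-β ⟩
      at x β (t + e) ≡⟨ cong (at x β) (sym (+≡⇒∸≡ _ _ _ t+e+v≡)) ⟩
      at x β (L ∸ suc v) ≡⟨ β-tail (suc v) (s≤s z≤n) (middle-tail-bound L t e (suc v) r n t+e+v≡ middle₁) ⟩
      cyc x γ (n * M ∸ suc v) ≡⟨ cong (cyc x γ) (+≡⇒∸≡ _ _ _ (middle-tail-offset L A t (n * M) e (suc v) L+A≡ t+e+v≡)) ⟩
      cyc x γ (A + e) ∎
    where open ≡-Reasoning
  middle-symbol t A e L+A≡ middle₁ middle₂ e<n | no past-β with t + e <? N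
  ... | yes in-γ with m≤n⇒∃[o]m+o≡n (≮⇒≥ past-β)
  ...   | j , L+j≡ = begin
      cyc x U (t + e) ≡⟨ cong (cyc x U) (sym L+j≡) ⟩
      cyc x U (L + j) ≡⟨ cycU-γ j j<M ⟩
      at x γ j ≡⟨ sym (cyc-< x γ j j<M) ⟩
      cyc x γ j ≡⟨ sym (cyc-+period x γ j n) ⟩
      cyc x γ (j + n * M) ≡⟨ cong (cyc x γ) (sym (middle-γ-offset L A t (n * M) e j L+A≡ L+j≡)) ⟩
      cyc x γ (A + e) ∎
    where open ≡-Reasoning
          j<M : j < M
          j<M = +-cancelˡ-< L j M (subst (_< N) (sym L+j≡) in-γ)
  middle-symbol t A e L+A≡ middle₁ middle₂ e<n | no past-β | no past-γ with m≤n⇒∃[o]m+o≡n (≮⇒≥ past-γ)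
  ...   | j , N+j≡ = begin
      cyc x U (t + e) ≡⟨ cong (cyc x U) (sym N+j≡) ⟩
      cyc x U (N + j) ≡⟨ cycU-wrap j (<-trans j<r r<L) ⟩
      at x β j ≡⟨ β-prefix j j<r ⟩
      x ≡⟨ sym (γ-prefix j j<r) ⟩
      at x γ j ≡⟨ sym (cyc-< x γ j (<-trans j<r r<M)) ⟩
      cyc x γ j ≡⟨ sym (cyc-+period x γ j (suc n)) ⟩
      cyc x γ (j + suc n * M) ≡⟨ cong (cyc x γ) (sym (middle-wrap-offset L M A t (n * M) e j L+A≡ N+j≡)) ⟩
      cyc x γ (A + e) ∎
    where open ≡-Reasoning
          j<r : j < r
          j<r = overhang<r N j t e n r N+j≡ e<n middle₂

  -- back (N + r < t + n, so t = M + s): the window wraps around and reads as β at s,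
  -- since the tail of β is periodic with period M.
  back-symbol : ∀ s e → M + s < N → N + r < M + s + n → e < n → cyc x U (M + s + e) ≡ cyc x β (s + e)
  back-symbol s e M+s<N back e<n with M + s + e <? L
  ... | yes in-β with <⇒∃suc in-β
  ...   | v , M+s+e+v≡ = begin
      cyc x U (M + s + e) ≡⟨ cycU-β _ in-β ⟩
      at x β (M + s + e) ≡⟨ cong (at x β) (sym (+≡⇒∸≡ _ _ _ M+s+e+v≡)) ⟩
      at x β (L ∸ suc v) ≡⟨ β-tail (suc v) (s≤s z≤n) (≤-<-trans (+-monoˡ-≤ r (m≤m+n (suc v) M)) far) ⟩
      cyc x γ (n * M ∸ suc v) ≡⟨ sym (cycγ-back-period n (suc v) (≤-trans (<⇒≤ (≤-<-trans (m≤m+n _ r) far)) n≤nM)) ⟩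
      cyc x γ (n * M ∸ (suc v + M)) ≡⟨ sym (β-tail (suc v + M) (s≤s z≤n) far) ⟩
      at x β (L ∸ (suc v + M)) ≡⟨ cong (at x β) (+≡⇒∸≡ _ _ _ s+e+v+M≡) ⟩
      at x β (s + e) ≡⟨ sym (cyc-< x β _ (≤-<-trans (subst (s + e ≤_) (sym (+-assoc M s e)) (m≤n+m (s + e) M)) in-β)) ⟩
      cyc x β (s + e) ∎
    where
    open ≡-Reasoning
    reorder : ∀ s e v M → s + e + (suc v + M) ≡ M + s + e + suc v
    reorder = solve-∀
    s+e+v+M≡ : s + e + (suc v + M) ≡ L
    s+e+v+M≡ = trans (reorder s e v M) M+s+e+v≡
    far : suc v + M + r < n
    far = back-tail-bound L M s e (suc v + M) r n s+e+v+M≡ back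
  back-symbol s e M+s<N back e<n | no past-β with M + s + e <? N
  ... | yes in-γ with m≤n⇒∃[o]m+o≡n (≮⇒≥ past-β)
  ...   | j , L+j≡ with <⇒∃suc (+-cancelˡ-< L j M (subst (_< N) (sym L+j≡) in-γ))
  ...     | w , j+w≡ = begin
      cyc x U (M + s + e) ≡⟨ cong (cyc x U) (sym L+j≡) ⟩
      cyc x U (L + j) ≡⟨ cycU-γ j j<M ⟩
      at x γ j ≡⟨ sym (cyc-< x γ j j<M) ⟩
      cyc x γ j ≡⟨ sym (cycγ-back n (suc w) j (≤-trans (+≡⇒≤ (suc w) j M (trans (+-comm (suc w) j) j+w≡)) M≤nM) j+w≡) ⟩
      cyc x γ (n * M ∸ suc w) ≡⟨ sym (β-tail (suc w) (s≤s z≤n) (back-tail-bound L M s e (suc w) r n s+e+w≡ back)) ⟩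
      at x β (L ∸ suc w) ≡⟨ cong (at x β) (+≡⇒∸≡ _ _ _ s+e+w≡) ⟩
      at x β (s + e) ≡⟨ sym (cyc-< x β _ (+≡⇒≤ (suc (s + e)) w L (trans (sym (+-suc (s + e) w)) s+e+w≡))) ⟩
      cyc x β (s + e) ∎
    where
    open ≡-Reasoning
    j<M : j < M
    j<M = +≡⇒≤ (suc j) w M (trans (sym (+-suc j w)) j+w≡)
    s+e+w≡ : s + e + suc w ≡ L
    s+e+w≡ = back-in-γ-offset L j M s e (suc w) L+j≡ j+w≡
  back-symbol s e M+s<N back e<n | no past-β | no past-γ with m≤n⇒∃[o]m+o≡n (≮⇒≥ past-γ)
  ...   | j , N+j≡ = begin
      cyc x U (M + s + e) ≡⟨ cong (cyc x U) (sym N+j≡) ⟩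
      cyc x U (N + j) ≡⟨ cycU-wrap j j<L ⟩
      at x β j ≡⟨ sym (cycβ-wrap j j<L) ⟩
      cyc x β (L + j) ≡⟨ cong (cyc x β) (sym s+e≡) ⟩
      cyc x β (s + e) ∎
    where
    open ≡-Reasoning
    s+e≡ : s + e ≡ L + j
    s+e≡ = back-wrap-offset L M j s e N+j≡
    j<L : j < L
    j<L = +-cancelˡ-< L j L (subst (_< L + L) s+e≡ (+-mono-< (back-offset<L M s L M+s<N) (<-≤-trans e<n n≤L)))

  win : Word k → ℕ → Word k
  win w s = applyUpTo (λ e → cyc x w (s + e)) n

  data Region (t : ℕ) : Set where
    front  : t + n ≤ L + r → Region t
    middle : L + r < t + n → t + n ≤ N + r → Region t
    back   : ∀ s → t ≡ M + s → N + r < t + n → Region t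

  region : ∀ t → Region t
  region t with t + n ≤? L + r | t + n ≤? N + r
  ... | yes in-front | _ = front in-front
  ... | no ¬front | yes in-middle = middle (≰⇒> ¬front) in-middle
  ... | no _ | no ¬middle with m≤n⇒∃[o]m+o≡n (back-start≥M L M r t n (≰⇒> ¬middle) n≤L)
  ...   | s , M+s≡t = back s (sym M+s≡t) (≰⇒> ¬middle)

  offset : ℕ → ℕ
  offset t = t + n * M ∸ L

  L+offset : ∀ t → L + r < t + n → L + offset t ≡ t + n * M
  L+offset t in-middle = m+[n∸m]≡n (≤-trans (≤-trans (m≤m+n L r) (<⇒≤ in-middle)) (+-monoʳ-≤ t n≤nM))

  -- Where the window of U at t comes from, as a position among
  -- "the positions of β, followed by those of γ".
  source : ℕ → ℕ
  source t with region t
  ... | front _ = t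
  ... | middle _ _ = L + offset t % M
  ... | back s _ _ = s

  joint : ℕ → Word k
  joint s with s <? L
  ... | yes _ = win β s
  ... | no _ = win γ (s ∸ L)

  joint-β : ∀ s → s < L → joint s ≡ win β s
  joint-β s s<L with s <? L
  ... | yes _ = refl
  ... | no s≮L = ⊥-elim (s≮L s<L)

  joint-γ : ∀ j → joint (L + j) ≡ win γ j
  joint-γ j with L + j <? L
  ... | yes L+j<L = ⊥-elim (≤⇒≯ (m≤m+n L j) L+j<L)
  ... | no _ = cong (win γ) (m+n∸m≡n L j)

  window-source : ∀ t → t < N → source t < N × win U t ≡ joint (source t)
  window-source t t<N with region t
  ... | front in-front = <-≤-trans t<L (m≤m+n L M) ,
        trans (applyUpTo-cong _ _ n (λ e e<n → front-symbol t e in-front e<n)) (sym (joint-β t t<L))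
    where t<L : t < L
          t<L = front-start<L t n L r in-front r<n
  ... | middle in-middle₁ in-middle₂ = +-monoʳ-< L (m%n<n (offset t) M) ,
        trans (applyUpTo-cong _ _ n (λ e e<n →
                 trans (middle-symbol t (offset t) e (L+offset t in-middle₁) in-middle₁ in-middle₂ e<n) (sym (cyc-% x γ (offset t) e))))
              (sym (joint-γ (offset t % M)))
  ... | back s refl in-back = <-≤-trans s<L (m≤m+n L M) ,
        trans (applyUpTo-cong _ _ n (λ e e<n → back-symbol s e t<N in-back e<n)) (sym (joint-β s s<L))
    where s<L : s < L
          s<L = back-offset<L M s L t<N

  -- Distinct middle starts have distinct residues, as they differ by less than M.
  middle-source-injective : ∀ t₁ t₂ → t₁ ≤ t₂ → L + r < t₁ + n → t₂ + n ≤ N + r → offset t₁ % M ≡ offset t₂ % M → t₁ ≡ t₂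
  middle-source-injective t₁ t₂ t₁≤t₂ in-middle₁ in-middle₂ same-residue with m≤n⇒∃[o]m+o≡n t₁≤t₂
  ... | c , refl = trans (sym (+-identityʳ t₁)) (cong (t₁ +_) (sym c≡0))
    where
    reorder : ∀ t c m → t + c + m ≡ t + m + c
    reorder = solve-∀
    shifted : offset (t₁ + c) ≡ offset t₁ + c
    shifted = trans (cong (_∸ L) (reorder t₁ c (n * M))) (+-∸-comm c (+≡⇒≤ L _ _ (L+offset t₁ in-middle₁)))
    c≡0 : c ≡ 0
    c≡0 = %-shift≡⇒0 M (offset t₁) c (middle-span<M t₁ c n L M r in-middle₁ in-middle₂)
            (trans (cong (_% M) (sym shifted)) (sym same-residue))

  front-middle-clash : ∀ t₁ t₂ → t₁ + n ≤ L + r → t₁ ≢ L + offset t₂ % M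
  front-middle-clash t₁ t₂ in-front eq = ≤⇒≯ (subst (L ≤_) (sym eq) (m≤m+n L _)) (front-start<L t₁ n L r in-front r<n)

  back-middle-clash : ∀ s t → M + s < N → s ≢ L + offset t % M
  back-middle-clash s t M+s<N eq = ≤⇒≯ (subst (L ≤_) (sym eq) (m≤m+n L _)) (back-offset<L M s L M+s<N)

  front-back-clash : ∀ t s → t + n ≤ L + r → N + r < M + s + n → t ≢ s
  front-back-clash t .t in-front in-back refl = front-back-disjoint t n L r M in-front in-back

  source-injective : ∀ t₁ t₂ → t₁ < N → t₂ < N → source t₁ ≡ source t₂ → t₁ ≡ t₂
  source-injective t₁ t₂ t₁<N t₂<N eq with region t₁ | region t₂
  ... | front _ | front _ = eq
  ... | front in-front | middle _ _ = ⊥-elim (front-middle-clash t₁ t₂ in-front eq)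
  ... | middle _ _ | front in-front = ⊥-elim (front-middle-clash t₂ t₁ in-front (sym eq))
  ... | front in-front | back s refl in-back = ⊥-elim (front-back-clash t₁ s in-front in-back eq)
  ... | back s refl in-back | front in-front = ⊥-elim (front-back-clash t₂ s in-front in-back (sym eq))
  ... | middle _ _ | back s refl _ = ⊥-elim (back-middle-clash s t₁ t₂<N (sym eq))
  ... | back s refl _ | middle _ _ = ⊥-elim (back-middle-clash s t₂ t₁<N eq)
  ... | back s₁ refl _ | back s₂ refl _ = cong (M +_) eq
  ... | middle above₁ below₁ | middle above₂ below₂ with ≤-total t₁ t₂
  ...   | inj₁ t₁≤t₂ = middle-source-injective t₁ t₂ t₁≤t₂ above₁ below₂ (+-cancelˡ-≡ L _ _ eq)
  ...   | inj₂ t₂≤t₁ = sym (middle-source-injective t₂ t₁ t₂≤t₁ above₂ below₁ (+-cancelˡ-≡ L _ _ (sym eq)))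

  below-N : (i : Fin (length U)) → toℕ i < N
  below-N i = subst (toℕ i <_) length-U (toℕ<n i)

  permutation : Fin (length U) → Fin (length U)
  permutation i = fromℕ< (subst (source (toℕ i) <_) (sym length-U) (proj₁ (window-source (toℕ i) (below-N i))))

  permutation-injective : ∀ i j → permutation i ≡ permutation j → i ≡ j
  permutation-injective i j eq = toℕ-injective (source-injective _ _ (below-N i) (below-N j) (fromℕ<-injective _ _ _ _ eq))

  source-onto : ∀ s → s < N → ∃ λ (i : Fin (length U)) → source (toℕ i) ≡ s
  source-onto s s<N with injective⇒onto permutation permutation-injective (fromℕ< (subst (s <_) (sym length-U) s<N))
  ... | i , hit = i , fromℕ<-injective _ _ _ _ hit

  merged-endsLike : EndsLike n x U γ
  merged-endsLike u 1≤u u≤n with u ≤? M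
  ... | yes u≤M with m≤n⇒∃[o]m+o≡n u≤M
  ...   | w , u+w≡M = begin
      at x U (length U ∸ u) ≡⟨ cong (at x U) (+≡⇒∸≡ (L + w) u (length U) (trans (+-assoc L w u) (trans (cong (L +_) (trans (+-comm w u) u+w≡M)) (sym length-U)))) ⟩
      at x U (L + w) ≡⟨ at-++ʳ x β γ w ⟩
      at x γ w ≡⟨ sym (cyc-< x γ w w<M) ⟩
      cyc x γ w ≡⟨ sym (cycγ-back n u w (≤-trans u≤n n≤nM) (trans (+-comm w u) u+w≡M)) ⟩
      cyc x γ (n * M ∸ u) ∎
    where
    open ≡-Reasoning
    w<M : w < M
    w<M = subst (w <_) u+w≡M (+-monoˡ-≤ w 1≤u)
  merged-endsLike u 1≤u u≤n | no u≰M with <⇒∃suc (≰⇒> u≰M)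
  ... | v , M+v≡u = begin
      at x U (length U ∸ u) ≡⟨ cong (at x U) in-β ⟩
      at x U (L ∸ suc v) ≡⟨ at-++ˡ x β γ _ (∸-monoʳ-< (s≤s z≤n) (≤-trans (m≤m+n (suc v) M) (≤-trans (≤-reflexive v+M≡u) u≤L))) ⟩
      at x β (L ∸ suc v) ≡⟨ β-tail (suc v) (s≤s z≤n) (<-≤-trans (+-monoʳ-< (suc v) r<M) (subst (_≤ n) (sym v+M≡u) u≤n)) ⟩
      cyc x γ (n * M ∸ suc v) ≡⟨ sym (cycγ-back-period n (suc v) (≤-trans (≤-trans (≤-reflexive v+M≡u) u≤n) n≤nM)) ⟩
      cyc x γ (n * M ∸ (suc v + M)) ≡⟨ cong (λ z → cyc x γ (n * M ∸ z)) v+M≡u ⟩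
      cyc x γ (n * M ∸ u) ∎
    where
    open ≡-Reasoning
    v+M≡u : suc v + M ≡ u
    v+M≡u = trans (+-comm (suc v) M) M+v≡u
    u≤L : u ≤ L
    u≤L = ≤-trans u≤n n≤L
    in-β : length U ∸ u ≡ L ∸ suc v
    in-β = trans (cong (_∸ u) length-U) (trans (cong (N ∸_) (sym M+v≡u))
             (trans (sym (∸-+-assoc N M (suc v))) (cong (_∸ suc v) (m+n∸n≡m L M))))

  -- If β and γ are universal cycles for disjoint sets T and R, then U is one for T ∪ R:
  -- the windows of β and γ enumerate T ∪ R without repetition, and those of U are
  -- the same windows permuted by source.
  module _ (T R : WordSet k) (uc-β : IsUC n T β) (uc-γ : IsUC n R γ) (disjoint : ∀ w → T w → R w → ⊥) where

    window-at : ∀ (w : Word k) s (s<w : s < length w) → window n w (fromℕ< s<w) ≡ win w s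
    window-at w s s<w = trans (window-cyc x n w _) (cong (win w) (toℕ-fromℕ< s<w))

    β-in-T : ∀ s → s < L → T (win β s)
    β-in-T s s<L = subst T (window-at β s s<L) (proj₁ (proj₂ uc-β) (fromℕ< s<L))

    γ-in-R : ∀ j → j < M → R (win γ j)
    γ-in-R j j<M = subst R (window-at γ j j<M) (proj₁ (proj₂ uc-γ) (fromℕ< j<M))

    γ-index<M : ∀ s → s < N → s ∸ L < M
    γ-index<M s s<N = m<n+o⇒m∸n<o s L s<N

    joint-member : ∀ s → s < N → T (joint s) ⊎ R (joint s)
    joint-member s s<N with s <? L
    ... | yes s<L = inj₁ (β-in-T s s<L)
    ... | no _ = inj₂ (γ-in-R (s ∸ L) (γ-index<M s s<N))

    joint-onto : ∀ w → T w ⊎ R w → ∃ λ s → s < N × joint s ≡ w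
    joint-onto w (inj₁ Tw) with proj₁ (proj₂ (proj₂ uc-β)) w Tw
    ... | i , window≡w = toℕ i , <-≤-trans (toℕ<n i) (m≤m+n L M) ,
          trans (joint-β (toℕ i) (toℕ<n i)) (trans (sym (window-cyc x n β i)) window≡w)
    joint-onto w (inj₂ Rw) with proj₁ (proj₂ (proj₂ uc-γ)) w Rw
    ... | j , window≡w = L + toℕ j , +-monoʳ-< L (toℕ<n j) ,
          trans (joint-γ (toℕ j)) (trans (sym (window-cyc x n γ j)) window≡w)

    joint-injective : ∀ s s' → s < N → s' < N → joint s ≡ joint s' → s ≡ s'
    joint-injective s s' s<N s'<N eq with s <? L | s' <? L
    ... | yes s<L | yes s'<L = fromℕ<-injective s s' s<L s'<L
          (proj₂ (proj₂ (proj₂ uc-β)) _ _ (trans (window-at β s s<L) (trans eq (sym (window-at β s' s'<L)))))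
    ... | no s≮L | no s'≮L = ∸-cancelʳ-≡ (≮⇒≥ s≮L) (≮⇒≥ s'≮L) (fromℕ<-injective _ _ (γ-index<M s s<N) (γ-index<M s' s'<N)
          (proj₂ (proj₂ (proj₂ uc-γ)) _ _ (trans (window-at γ _ (γ-index<M s s<N)) (trans eq (sym (window-at γ _ (γ-index<M s' s'<N)))))))
    ... | yes s<L | no _ = ⊥-elim (disjoint _ (β-in-T s s<L) (subst R (sym eq) (γ-in-R _ (γ-index<M s' s'<N))))
    ... | no _ | yes s'<L = ⊥-elim (disjoint _ (β-in-T s' s'<L) (subst R eq (γ-in-R _ (γ-index<M s s<N))))

    window-joint : ∀ (i : Fin (length U)) → window n U i ≡ joint (source (toℕ i))
    window-joint i = trans (window-cyc x n U i) (proj₂ (window-source (toℕ i) (below-N i)))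

    merged-UC : IsUC n (λ w → T w ⊎ R w) U
    merged-UC = nonempty , member , onto , injective
      where
      nonempty : 1 ≤ length U
      nonempty = subst (1 ≤_) (sym length-U) (≤-trans (proj₁ uc-β) (m≤m+n L M))
      member : ∀ i → T (window n U i) ⊎ R (window n U i)
      member i = subst (λ w → T w ⊎ R w) (sym (window-joint i))
        (joint-member _ (proj₁ (window-source (toℕ i) (below-N i))))
      onto : ∀ w → T w ⊎ R w → ∃ λ i → window n U i ≡ w
      onto w Tw⊎Rw with joint-onto w Tw⊎Rw
      ... | s , s<N , joint≡w with source-onto s s<N
      ...   | i , source≡s = i , trans (window-joint i) (trans (cong joint source≡s) joint≡w)
      injective : ∀ i j → window n U i ≡ window n U j → i ≡ j
      injective i j eq = toℕ-injective (source-injective _ _ (below-N i) (below-N j)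
        (joint-injective _ _ (proj₁ (window-source _ (below-N i))) (proj₁ (window-source _ (below-N j)))
          (trans (sym (window-joint i)) (trans eq (window-joint j)))))

module Chain {k n : ℕ} (x : Fin k) (1≤n : 1 ≤ n) where
  open FinFacts

  open import Data.Nat hiding (_≟_)
  open import Data.Nat.Properties hiding (_≟_)
  open import Data.Fin using (Fin; zero; suc; inject₁; fromℕ)
  open import Data.Fin.Properties using (fromℕ≢inject₁; inject₁-injective)
  open import Data.List using (_++_; length)
  open import Data.Product using (∃; _×_; _,_; proj₁; proj₂)
  open import Data.Sum using (_⊎_; inj₁; inj₂)
  open import Data.Empty using (⊥)
  import Data.List.Properties
  open import Relation.Binary.PropositionalEquality
  open Indexing
  open Words

  -- The x-prefix
  -- of ext γ before its first other symbol is shorter than |γ|, is shared by β,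
  -- and what follows it in the suffix relation makes the tail of β read as γγγ⋯.
  append : ∀ (β αm γ : Word k) (T R : WordSet k) →
    IsUC n T β → n ≤ length β → EndsLike n x β αm → 1 ≤ length αm →
    IsUC n R γ → (∀ w → T w → R w → ⊥) → xRun x γ ≤ xRun x β →
    SuffixRelated x n (ext n αm) (ext n γ) →
    IsUC n (λ w → T w ⊎ R w) (β ++ γ) × EndsLike n x (β ++ γ) γ
  append β αm γ T R uc-β n≤β β-ends 1≤αm uc-γ disjoint runs
         (n≤E₁ , n≤E₂ , _ , p , p<n , x-prefix , (y , rest , drop≡ , y≢x) , same-suffix) =
    merged-UC T R uc-β uc-γ disjoint , merged-endsLike
    where
    1≤γ : 1 ≤ length γ
    1≤γ = proj₁ uc-γ
    E₂ : Word k
    E₂ = ext n γ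
    E₂-reads-γ : ∀ i → i < length E₂ → at x E₂ i ≡ cyc x γ i
    E₂-reads-γ = ext-reads n x γ 1≤γ
    p<E₂ : p < length E₂
    p<E₂ = proj₁ (drop≡∷⇒at x E₂ p y rest drop≡)
    E₂-prefix : ∀ i → i < p → at x E₂ i ≡ x
    E₂-prefix = All-take⇒at x E₂ p x-prefix (<⇒≤ p<E₂)
    p<γ : p < length γ
    p<γ = run<period x x γ E₂ p 1≤γ E₂-reads-γ E₂-prefix p<E₂
            (λ at≡x → y≢x (trans (sym (proj₂ (drop≡∷⇒at x E₂ p y rest drop≡))) at≡x))
    γ-prefix : ∀ i → i < p → at x γ i ≡ x
    γ-prefix i i<p = trans (sym (cyc-< x γ i (<-trans i<p p<γ))) (trans (sym (E₂-reads-γ i (<-trans i<p p<E₂))) (E₂-prefix i i<p))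
    β-prefix : ∀ i → i < p → at x β i ≡ x
    β-prefix i i<p = xRun-at x x β i (<-≤-trans i<p (≤-trans (xRun-≥ x x γ p (<⇒≤ p<γ) γ-prefix) runs))
    β-tail : ∀ u → 1 ≤ u → u + p < n → at x β (length β ∸ u) ≡ cyc x γ (n * length γ ∸ u)
    β-tail u 1≤u u+p<n = begin
      at x β (length β ∸ u) ≡⟨ β-ends u 1≤u u≤n ⟩
      cyc x αm (n * length αm ∸ u) ≡⟨ sym (ext-endsLike n x αm 1≤αm u 1≤u u≤n) ⟩
      at x (ext n αm) (length (ext n αm) ∸ u) ≡⟨ suff-≡⇒tail x (n ∸ suc p) _ _ (≤-trans (m∸n≤m n (suc p)) n≤E₁) (≤-trans (m∸n≤m n (suc p)) n≤E₂) same-suffix u u≤l ⟩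
      at x E₂ (length E₂ ∸ u) ≡⟨ ext-endsLike n x γ 1≤γ u 1≤u u≤n ⟩
      cyc x γ (n * length γ ∸ u) ∎
      where
      open ≡-Reasoning
      u≤n : u ≤ n
      u≤n = ≤-trans (m≤m+n u p) (<⇒≤ u+p<n)
      u≤l : u ≤ n ∸ suc p
      u≤l = subst (_≤ n ∸ suc p) (m+n∸n≡m u (suc p)) (∸-monoˡ-≤ (suc p) (subst (_≤ n) (sym (+-suc u p)) u+p<n))
    open Merge x n β γ p n≤β p<γ p<n β-prefix γ-prefix β-tail

  chain : ∀ m (α : Fin (suc m) → Word k) (Ss : Fin (suc m) → WordSet k) →
    (∀ i → IsUC n (Ss i) (α i)) →
    (∀ i j w → Ss i w → Ss j w → i ≡ j) →
    n ≤ length (α zero) →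
    (∀ i → xRun x (α i) ≤ xRun x (α zero)) →
    (∀ (i : Fin m) → SuffixRelated x n (ext n (α (inject₁ i))) (ext n (α (suc i)))) →
    IsUC n (λ w → ∃ λ i → Ss i w) (concatF α) × EndsLike n x (concatF α) (α (fromℕ m))
  chain zero α Ss ucs _ n≤α₀ _ _ =
    subst (IsUC n _) (sym (Data.List.Properties.++-identityʳ (α zero)))
      (IsUC-cong (λ w s → zero , s) (λ { w (zero , s) → s }) (ucs zero)) ,
    power-endsLike n x 1 (α zero) (≤-trans 1≤n n≤α₀) (subst (n ≤_) (sym (trans (length-power 1 (α zero)) (*-identityˡ _))) n≤α₀)
  chain (suc m) α Ss ucs disjoint n≤α₀ runs related =
    subst (IsUC n _) (sym (concatF-snoc m α)) (IsUC-cong regroup ungroup (proj₁ step)) ,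
    subst (λ v → EndsLike n x v γ) (sym (concatF-snoc m α)) (proj₂ step)
    where
    α′ : Fin (suc m) → Word k
    α′ i = α (inject₁ i)
    γ : Word k
    γ = α (fromℕ (suc m))
    earlier : Fin (suc m) → WordSet k
    earlier i = Ss (inject₁ i)
    previous : IsUC n (λ w → ∃ λ i → earlier i w) (concatF α′) × EndsLike n x (concatF α′) (α′ (fromℕ m))
    previous = chain m α′ earlier (λ i → ucs (inject₁ i)) (λ i j w a b → inject₁-injective (disjoint _ _ w a b))
                 n≤α₀ (λ i → runs (inject₁ i)) (λ i → related (inject₁ i))
    step : IsUC n (λ w → (∃ λ i → earlier i w) ⊎ Ss (fromℕ (suc m)) w) (concatF α′ ++ γ) × EndsLike n x (concatF α′ ++ γ) γ
    step = append (concatF α′) (α′ (fromℕ m)) γ (λ w → ∃ λ i → earlier i w) (Ss (fromℕ (suc m)))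
             (proj₁ previous) (≤-trans n≤α₀ (Data.List.Properties.length-++-≤ˡ (α zero))) (proj₂ previous)
             (proj₁ (ucs (inject₁ (fromℕ m)))) (ucs (fromℕ (suc m)))
             (λ { w (i , a) b → fromℕ≢inject₁ (sym (disjoint _ _ w a b)) })
             (≤-trans (runs (fromℕ (suc m))) (xRun-++ x (α zero) _)) (related (fromℕ m))
    regroup : ∀ w → (∃ λ i → earlier i w) ⊎ Ss (fromℕ (suc m)) w → ∃ λ i → Ss i w
    regroup w (inj₁ (i , s)) = inject₁ i , s
    regroup w (inj₂ s) = fromℕ (suc m) , s
    ungroup : ∀ w → (∃ λ i → Ss i w) → (∃ λ i → earlier i w) ⊎ Ss (fromℕ (suc m)) w
    ungroup w (i , s) with inject₁-or-last i
    ... | inj₁ (i' , refl) = inj₁ (i' , s)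
    ... | inj₂ refl = inj₂ s


theorem1 : (k n m : ℕ) → 2 ≤ k → 1 ≤ n →
  (S : WordSet k) → ⊆Σ^ n S → (∃ λ w → S w) →
  (Ss : Fin (suc m) → WordSet k) →
  (∀ w → S w → ∃ λ i → Ss i w) →
  (∀ i w → Ss i w → S w) →
  (∀ i j w → Ss i w → Ss j w → i ≡ j) →
  (α : Fin (suc m) → Word k) →
  (∀ i → IsUC n (Ss i) (α i)) →
  (x : Fin k) → (xs : List (Fin k)) → α zero ≡ x ∷ xs →
  n ≤ length (α zero) →
  (∀ i → xRun x (α i) ≤ xRun x (α zero)) →
  (∀ (i : Fin m) → SuffixRelated x n (ext n (α (inject₁ i))) (ext n (α (suc i)))) →
  IsUC n S (concatF α) × suff n (concatF α) ≡ suff n (ext n (α (fromℕ m)))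
theorem1 k n m _ 1≤n S _ _ Ss cover inside disjoint α ucs x _ _ n≤α₀ runs related =
  IsUC-cong (λ w (i , s) → inside i w s) cover union-UC ,
  suff-≡ x n (concatF α) (ext n αm) n≤U (ext-long n αm 1≤αm) same-tail
  where
  open Indexing
  open Words
  open import Data.Product using (proj₁; proj₂)
  open import Data.List.Properties using (length-++-≤ˡ)
  open import Data.Nat.Properties using (≤-trans)
  open import Relation.Binary.PropositionalEquality using (sym; trans)
  αm : Word k
  αm = α (fromℕ m)
  1≤αm : 1 ≤ length αm
  1≤αm = proj₁ (ucs (fromℕ m))
  built : IsUC n (λ w → ∃ λ i → Ss i w) (concatF α) × EndsLike n x (concatF α) αm
  built = Chain.chain x 1≤n m α Ss ucs disjoint n≤α₀ runs related
  union-UC : IsUC n (λ w → ∃ λ i → Ss i w) (concatF α)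
  union-UC = proj₁ built
  same-tail : ∀ u → 1 ≤ u → u ≤ n → at x (concatF α) (length (concatF α) ∸ u) ≡ at x (ext n αm) (length (ext n αm) ∸ u)
  same-tail u 1≤u u≤n = trans (proj₂ built u 1≤u u≤n) (sym (ext-endsLike n x αm 1≤αm u 1≤u u≤n))
  n≤U : n ≤ length (concatF α)
  n≤U = ≤-trans n≤α₀ (length-++-≤ˡ (α zero))
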